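{- Let $n\ge1$. If $0\le r<n$, then $$s(n,r,k)=\begin{cases} s(n-1,r,k) & \text{if } 0\le k<n-r,\\ s(n-1,r,k)+s(n-1,r,k-(n-r)) & \text{if } n-r\le k\le R(n-1,r),\\ s(n-1,r,k-(n-r)) & \text{if } R(n-1,r)<k\le R(n,r).\end{cases}$$ If $r=n$, then $s(n,n,k)=s(n,0,k)$ for all $k$.
   Context: For integers $0\le r\le n$, $A(n,r)$ is an alphabet of $n+1$ formal symbols $\tilde 1,\dots,\tilde r,\ 0^\S,\ \bar 1,\dots,\overline{n-r}$, totally ordered by $\overline{n-r}\prec\cdots\prec\bar1\prec 0^\S\prec\tilde1\prec\cdots\prec\tilde r$. $S(n,r)$ is the set of strings $w=i_1\cdots i_r\,|\,j_1\cdots j_{n-r}$ with $i_k\in\{\tilde1,\dots,\tilde r,0^\S\}$, $j_k\in\{0^\S,\bar1,\dots,\overline{n-r}\}$ such that for some $0\le p\le r$, $1\le q\le n-r+1$: $i_1\succ\cdots\succ i_p\succ 0^\S=i_{p+1}=\cdots=i_r$ and $j_1=\cdots=j_{q-1}=0^\S\succ j_q\succ\cdots\succ j_{n-r}$, ordered componentwise by $\preceq$; $S(0,0)$ is a single (empty) string. $S(n,r)$ is a finite distributive lattice, hence graded; its rank is $R(n,r)=\binom{r+1}{2}+\binom{n-r+1}{2}$. For $0\le k\le R(n,r)$, $s(n,r,k)$ denotes the number of elements of $S(n,r)$ of rank $k$. -}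

module Defs where

open import Data.Nat using (ℕ; zero; suc; _+_; _∸_; _≤ᵇ_; _≡ᵇ_; _⊔_)
open import Data.Nat.Combinatorics using (_C_)
open import Data.Fin using (Fin; toℕ)
open import Data.Bool using (Bool; true; false; _∧_; _∨_; not)
open import Data.List using (List; []; _∷_; map; filter; length; concatMap; _++_; foldr; allFin)
open import Data.Vec using (Vec; []; _∷_)
open import Data.Product using (_×_; _,_)
open import Relation.Nullary.Decidable using (does)
open import Relation.Binary.PropositionalEquality using (_≡_; refl)
open import Data.Bool using (T)
open import Data.Bool.Properties using (T?)

-- The alphabet A(n,r) with a = r and b = n - r:
--   tl i  stands for  \tilde{i+1}   (i : Fin a, i.e. \tilde 1 … \tilde r)
--   zS    stands for  0^§
--   br j  stands for  \bar{j+1}     (j : Fin b, i.e. \bar 1 … \bar{n-r})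
-- Total order:  \bar{b} ≺ … ≺ \bar 1 ≺ 0^§ ≺ \tilde 1 ≺ … ≺ \tilde a.

data Sym (a b : ℕ) : Set where
  tl : Fin a → Sym a b
  zS : Sym a b
  br : Fin b → Sym a b

_≼ᵇ_ : ∀ {a b} → Sym a b → Sym a b → Bool
br i ≼ᵇ br j = toℕ j ≤ᵇ toℕ i
br _ ≼ᵇ zS   = true
br _ ≼ᵇ tl _ = true
zS   ≼ᵇ br _ = false
zS   ≼ᵇ zS   = true
zS   ≼ᵇ tl _ = true
tl _ ≼ᵇ br _ = false
tl _ ≼ᵇ zS   = false
tl i ≼ᵇ tl j = toℕ i ≤ᵇ toℕ j

_≺ᵇ_ : ∀ {a b} → Sym a b → Sym a b → Bool
x ≺ᵇ y = (x ≼ᵇ y) ∧ not (y ≼ᵇ x)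

isZ : ∀ {a b} → Sym a b → Bool
isZ zS = true
isZ _  = false

isBar : ∀ {a b} → Sym a b → Bool
isBar (br _) = true
isBar _      = false

isTilde : ∀ {a b} → Sym a b → Bool
isTilde (tl _) = true
isTilde _      = false

-- Left word i_1 … i_r : all letters in {\tilde 1,…,\tilde r, 0^§}, and
--   i_1 ≻ … ≻ i_p ≻ 0^§ = i_{p+1} = … = i_r  for some p,
-- which is checked on consecutive letters: a letter 0^§ is followed by 0^§,
-- and a letter \tilde t is followed by a strictly smaller letter.
validL : ∀ {a b m} → Vec (Sym a b) m → Bool
validL [] = true
validL (x ∷ []) = not (isBar x)
validL (x ∷ y ∷ xs) =
  not (isBar x) ∧ (if isZ x then isZ y else (y ≺ᵇ x)) ∧ validL (y ∷ xs)
  where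
  if_then_else_ : Bool → Bool → Bool → Bool
  if true  then t else e = t
  if false then t else e = e

-- Right word j_1 … j_{n-r} : all letters in {0^§, \bar 1, …, \bar{n-r}}, and
--   j_1 = … = j_{q-1} = 0^§ ≻ j_q ≻ … ≻ j_{n-r}  for some q,
-- checked on consecutive letters: a letter \bar t is followed by a strictly
-- smaller letter (0^§ may be followed by anything allowed).
validR : ∀ {a b m} → Vec (Sym a b) m → Bool
validR [] = true
validR (x ∷ []) = not (isTilde x)
validR (x ∷ y ∷ xs) =
  not (isTilde x) ∧ (isZ x ∨ (y ≺ᵇ x)) ∧ validR (y ∷ xs)

Str : ℕ → ℕ → Set
Str n r = Vec (Sym r (n ∸ r)) r × Vec (Sym r (n ∸ r)) (n ∸ r)

allSym : (a b : ℕ) → List (Sym a b)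
allSym a b = map tl (allFin a) ++ (zS ∷ map br (allFin b))

allVecs : ∀ {A : Set} → List A → (m : ℕ) → List (Vec A m)
allVecs xs zero    = [] ∷ []
allVecs xs (suc m) = concatMap (λ x → map (x ∷_) (allVecs xs m)) xs

isS : ∀ {n r} → Str n r → Bool
isS (u , v) = validL u ∧ validR v

elems : (n r : ℕ) → List (Str n r)
elems n r =
  filter (λ w → T? (isS w))
    (concatMap (λ u → map (u ,_) (allVecs (allSym r (n ∸ r)) (n ∸ r)))
               (allVecs (allSym r (n ∸ r)) r))

vle : ∀ {a b m} → Vec (Sym a b) m → Vec (Sym a b) m → Bool
vle [] [] = true
vle (x ∷ xs) (y ∷ ys) = (x ≼ᵇ y) ∧ vle xs ys

veq : ∀ {a b m} → Vec (Sym a b) m → Vec (Sym a b) m → Bool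
veq xs ys = vle xs ys ∧ vle ys xs

_≤S_ : ∀ {n r} → Str n r → Str n r → Bool
(u , v) ≤S (u' , v') = vle u u' ∧ vle v v'

_<S_ : ∀ {n r} → Str n r → Str n r → Bool
(u , v) <S (u' , v') = ((u , v) ≤S (u' , v')) ∧ not (veq u u' ∧ veq v v')

-- Rank in the graded poset S(n,r): the length of a longest chain
-- x_0 < x_1 < … < x_m = x in S(n,r) ending at x (equivalently, since S(n,r)
-- is graded with a least element, the length of any maximal chain from the
-- bottom to x).  Computed with fuel; fuel = |S(n,r)| suffices since every
-- chain has at most |S(n,r)| elements.

maxL : List ℕ → ℕ
maxL = foldr _⊔_ 0

height : ∀ {n r} → ℕ → Str n r → ℕ
height {n} {r} zero    x = 0
height {n} {r} (suc f) x =
  maxL (map (λ y → suc (height f y)) (filter (λ y → T? (y <S x)) (elems n r)))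

rank : ∀ {n r} → Str n r → ℕ
rank {n} {r} x = height (length (elems n r)) x

s : ℕ → ℕ → ℕ → ℕ
s n r k = length (filter (λ x → T? (rank x ≡ᵇ k)) (elems n r))

R : ℕ → ℕ → ℕ
R n r = (suc r C 2) + (suc (n ∸ r) C 2)

module Submission where

-- A valid left word i_1 ⋯ i_r is determined by the set S ⊆ {1, …, r} of indices of its
-- tildes, and a valid right word j_1 ⋯ j_{n-r} by the set S′ ⊆ {1, …, n - r} of indices of
-- its bars. The function ΣS + Σ({1, …, n - r} ∖ S′) is strictly monotone on S(n,r), and
-- every element where it is positive covers an element where it is one less; hence it is
-- the rank. Since complementation permutes the subsets of {1, …, n - r}, this gives
--   Σ_k s(n,r,k) q^k = ∏_{i ≤ r} (1 + q^i) · ∏_{j ≤ n - r} (1 + q^j).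
-- Passing from n - 1 to n with r fixed multiplies this by 1 + q^(n - r), which is the
-- recurrence; for r = n and r = 0 both sides are ∏_{i ≤ n} (1 + q^i).

open import Defs
open import Data.Nat using (ℕ; zero; suc; _+_; _*_; _∸_; _≤_; _<_; z≤n; s≤s; z<s; s<s; _≤ᵇ_; _<ᵇ_; _≡ᵇ_; _<?_; _≟_)
open import Data.Nat.Properties
open import Data.Nat.Combinatorics using (_C_; nC1≡n; nCk+nC[k+1]≡[n+1]C[k+1])
open import Algebra.Properties.CommutativeSemigroup +-commutativeSemigroup using (interchange; x∙yz≈y∙xz)
open import Data.Bool using (Bool; true; false; _∧_; not; T)
open import Data.Bool.Properties using (T?; T-≡)
open import Function.Bundles using (Equivalence)
open import Data.Unit using (tt)
open import Data.Empty using (⊥-elim)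
open import Data.Fin using (Fin; toℕ; fromℕ<; inject₁) renaming (zero to fzero; suc to fsuc)
open import Data.Fin.Properties using (toℕ<n; toℕ-fromℕ<; toℕ-inject₁; pigeonhole)
open import Data.Vec using (Vec; []; _∷_)
open import Data.List using (List; []; _∷_; map; filter; length; concatMap; _++_; tabulate; allFin; lookup)
open import Data.List.Membership.Propositional using (_∈_)
open import Data.List.Membership.Propositional.Properties using (∈-map⁺; ∈-map⁻; ∈-++⁺ˡ; ∈-++⁺ʳ; ∈-concatMap⁺; ∈-filter⁺; ∈-filter⁻; ∈-allFin)
open import Data.List.Relation.Unary.Any using (here; there; index) renaming (map to mapAny)
open import Data.List.Relation.Unary.Any.Properties using (lookup-index)
open import Data.Product using (_×_; _,_; proj₁; proj₂; Σ-syntax)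
open import Relation.Nullary using (¬_; yes; no)
open import Relation.Binary.PropositionalEquality using (_≡_; _≢_; refl; sym; trans; cong; cong₂; subst; module ≡-Reasoning)

private
  variable
    A B : Set

𝟙 : Bool → ℕ
𝟙 true  = 1
𝟙 false = 0

Σ< : ℕ → (ℕ → ℕ) → ℕ
Σ< zero    F = 0
Σ< (suc n) F = F 0 + Σ< n (λ i → F (suc i))

Σ<-cong : ∀ n {F G : ℕ → ℕ} → (∀ i → i < n → F i ≡ G i) → Σ< n F ≡ Σ< n G
Σ<-cong zero    eq = refl
Σ<-cong (suc n) eq = cong₂ _+_ (eq 0 z<s) (Σ<-cong n (λ i i<n → eq (suc i) (s<s i<n)))

Σ<-last : ∀ n F → Σ< (suc n) F ≡ Σ< n F + F n
Σ<-last zero    F = +-identityʳ (F 0)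
Σ<-last (suc n) F = trans (cong (F 0 +_) (Σ<-last n (λ i → F (suc i))))
                          (sym (+-assoc (F 0) _ _))

Σ<-+ : ∀ n F G → Σ< n (λ i → F i + G i) ≡ Σ< n F + Σ< n G
Σ<-+ zero    F G = refl
Σ<-+ (suc n) F G = trans (cong (F 0 + G 0 +_) (Σ<-+ n (λ i → F (suc i)) (λ i → G (suc i))))
                         (interchange (F 0) (G 0) _ _)

Σ<-zero : ∀ n → Σ< n (λ _ → 0) ≡ 0
Σ<-zero zero    = refl
Σ<-zero (suc n) = Σ<-zero n

Σ<-prefix : ∀ n t F → t ≤ n → Σ< n (λ i → 𝟙 (suc i ≤ᵇ t) * F i) ≡ Σ< t F
Σ<-prefix zero    zero    F _ = refl
Σ<-prefix (suc n) zero    F _ = Σ<-zero n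
Σ<-prefix (suc n) (suc t) F (s≤s t≤n) =
  cong₂ _+_ (*-identityˡ (F 0)) (Σ<-prefix n t (λ i → F (suc i)) t≤n)

-- Subset sums

tri : ℕ → ℕ
tri zero    = 0
tri (suc n) = suc n + tri n

tri≡C2 : ∀ n → suc n C 2 ≡ tri n
tri≡C2 zero    = refl
tri≡C2 (suc n) = trans (sym (nCk+nC[k+1]≡[n+1]C[k+1] (suc n) 1))
                       (cong₂ _+_ (nC1≡n (suc n)) (tri≡C2 n))

n≤tri : ∀ n → n ≤ tri n
n≤tri zero    = z≤n
n≤tri (suc n) = m≤m+n (suc n) (tri n)

-- subsetSum t g = Σ_{S ⊆ {1,…,t}} g (Σ S)
subsetSum : ℕ → (ℕ → ℕ) → ℕ
subsetSum zero    g = g 0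
subsetSum (suc t) g = subsetSum t g + subsetSum t (λ j → g (suc t + j))

subsetSum-cong : ∀ t {g g′ : ℕ → ℕ} → (∀ j → j ≤ tri t → g j ≡ g′ j) →
                 subsetSum t g ≡ subsetSum t g′
subsetSum-cong zero    eq = eq 0 z≤n
subsetSum-cong (suc t) eq = cong₂ _+_
  (subsetSum-cong t (λ j j≤ → eq j (≤-trans j≤ (m≤n+m (tri t) (suc t)))))
  (subsetSum-cong t (λ j j≤ → eq (suc t + j) (+-monoʳ-≤ (suc t) j≤)))

subsetSum-+ : ∀ t g h → subsetSum t (λ j → g j + h j) ≡ subsetSum t g + subsetSum t h
subsetSum-+ zero    g h = refl
subsetSum-+ (suc t) g h =
  trans (cong₂ _+_ (subsetSum-+ t g h) (subsetSum-+ t (λ j → g (suc t + j)) (λ j → h (suc t + j))))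
        (interchange (subsetSum t g) (subsetSum t h) _ _)

subsetSum-zero : ∀ t → subsetSum t (λ _ → 0) ≡ 0
subsetSum-zero zero    = refl
subsetSum-zero (suc t) = cong₂ _+_ (subsetSum-zero t) (subsetSum-zero t)

-- Splitting off the empty set and classifying the others by their maximum i + 1.
subsetSum-byMax : ∀ t g → subsetSum t g ≡ g 0 + Σ< t (λ i → subsetSum i (λ j → g (suc i + j)))
subsetSum-byMax zero    g = sym (+-identityʳ (g 0))
subsetSum-byMax (suc t) g = begin
  subsetSum t g + subsetSum t (λ j → g (suc t + j))
    ≡⟨ cong (_+ H t) (subsetSum-byMax t g) ⟩
  g 0 + Σ< t H + H t                  ≡⟨ +-assoc (g 0) (Σ< t H) (H t) ⟩
  g 0 + (Σ< t H + H t)                ≡⟨ cong (g 0 +_) (sym (Σ<-last t H)) ⟩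
  g 0 + Σ< (suc t) H                  ∎
  where
  open ≡-Reasoning
  H : ℕ → ℕ
  H i = subsetSum i (λ j → g (suc i + j))

-- Complementation S ↦ {1,…,t} ∖ S.
subsetSum-complement : ∀ t g → subsetSum t (λ j → g (tri t ∸ j)) ≡ subsetSum t g
subsetSum-complement zero    g = refl
subsetSum-complement (suc t) g = begin
  subsetSum t (λ j → g (tri (suc t) ∸ j)) + subsetSum t (λ j → g (tri (suc t) ∸ (suc t + j)))
    ≡⟨ cong₂ _+_ (subsetSum-cong t (λ j j≤ → cong g (+-∸-assoc (suc t) j≤)))
                 (subsetSum-cong t (λ j _ → cong g ([m+n]∸[m+o]≡n∸o (suc t) (tri t) j))) ⟩
  subsetSum t (λ j → g (suc t + (tri t ∸ j))) + subsetSum t (λ j → g (tri t ∸ j))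
    ≡⟨ cong₂ _+_ (subsetSum-complement t (λ j → g (suc t + j))) (subsetSum-complement t g) ⟩
  subsetSum t (λ j → g (suc t + j)) + subsetSum t g
    ≡⟨ +-comm _ (subsetSum t g) ⟩
  subsetSum t g + subsetSum t (λ j → g (suc t + j)) ∎
  where
  open ≡-Reasoning

-- exactSubsetSum b m lo g = Σ g (Σ S) over the m-element subsets S ⊆ {lo + 1, …, b}
exactSubsetSum : ℕ → ℕ → ℕ → (ℕ → ℕ) → ℕ
exactSubsetSum b zero    lo g = g 0
exactSubsetSum b (suc m) lo g =
  Σ< b (λ i → 𝟙 (lo ≤ᵇ i) * exactSubsetSum b m (suc i) (λ j → g (suc i + j)))

-- boundedSubsetSum b m g = Σ g (Σ S) over the subsets S ⊆ {1, …, b} with at most m elements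
boundedSubsetSum : ℕ → ℕ → (ℕ → ℕ) → ℕ
boundedSubsetSum b zero    g = g 0
boundedSubsetSum b (suc m) g = boundedSubsetSum b m g + exactSubsetSum b (suc m) 0 g

exactSubsetSum-cong : ∀ b m lo {g g′ : ℕ → ℕ} → (∀ j → g j ≡ g′ j) →
                      exactSubsetSum b m lo g ≡ exactSubsetSum b m lo g′
exactSubsetSum-cong b zero    lo eq = eq 0
exactSubsetSum-cong b (suc m) lo eq = Σ<-cong b (λ i _ →
  cong (𝟙 (lo ≤ᵇ i) *_) (exactSubsetSum-cong b m (suc i) (λ j → eq (suc i + j))))

exactSubsetSum-tooLarge : ∀ b m lo g → b < lo + suc m → exactSubsetSum b (suc m) lo g ≡ 0
exactSubsetSum-tooLarge b zero lo g b<lo+1 = trans (Σ<-cong b term≡0) (Σ<-zero b)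
  where
  term≡0 : ∀ i → i < b → 𝟙 (lo ≤ᵇ i) * g (suc i + 0) ≡ 0
  term≡0 i i<b with lo ≤ᵇ i in lo≤ᵇi
  ... | false = refl
  ... | true  = ⊥-elim (<-irrefl refl (<-≤-trans i<b (≤-trans b≤lo lo≤i)))
    where
    lo≤i = ≤ᵇ⇒≤ lo i (Equivalence.from T-≡ lo≤ᵇi)
    b≤lo = ≤-pred (subst (b <_) (+-comm lo 1) b<lo+1)
exactSubsetSum-tooLarge b (suc m) lo g b<lo+m = trans (Σ<-cong b term≡0) (Σ<-zero b)
  where
  term≡0 : ∀ i → i < b → 𝟙 (lo ≤ᵇ i) * exactSubsetSum b (suc m) (suc i) (λ j → g (suc i + j)) ≡ 0
  term≡0 i i<b with lo ≤ᵇ i in lo≤ᵇi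
  ... | false = refl
  ... | true  = cong (1 *_) (exactSubsetSum-tooLarge b m (suc i) (λ j → g (suc i + j))
                  (<-≤-trans b<lo+m (≤-trans (+-monoˡ-≤ (suc (suc m)) lo≤i) (≤-reflexive (+-suc i (suc m))))))
    where
    lo≤i = ≤ᵇ⇒≤ lo i (Equivalence.from T-≡ lo≤ᵇi)

-- An m-element subset of {lo + 1, …, b + 1} either avoids b + 1 or is {b + 1} plus an
-- (m - 1)-element subset of {lo + 1, …, b}.
exactSubsetSum-suc : ∀ b m lo g → lo ≤ b →
  exactSubsetSum (suc b) (suc m) lo g ≡
  exactSubsetSum b (suc m) lo g + exactSubsetSum b m lo (λ j → g (suc b + j))
exactSubsetSum-suc b zero lo g lo≤b = begin
  Σ< (suc b) H                  ≡⟨ Σ<-last b H ⟩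
  Σ< b H + H b                  ≡⟨ cong (λ c → Σ< b H + 𝟙 c * g (suc b + 0)) (Equivalence.to T-≡ (≤⇒≤ᵇ lo≤b)) ⟩
  Σ< b H + 1 * g (suc b + 0)    ≡⟨ cong (Σ< b H +_) (*-identityˡ _) ⟩
  Σ< b H + g (suc b + 0)        ∎
  where
  open ≡-Reasoning
  H : ℕ → ℕ
  H i = 𝟙 (lo ≤ᵇ i) * g (suc i + 0)
exactSubsetSum-suc b (suc m) lo g lo≤b = begin
  Σ< (suc b) H               ≡⟨ Σ<-last b H ⟩
  Σ< b H + H b               ≡⟨ cong (Σ< b H +_) Hb≡0 ⟩
  Σ< b H + 0                 ≡⟨ +-identityʳ _ ⟩
  Σ< b H                     ≡⟨ Σ<-cong b split ⟩
  Σ< b (λ i → H₁ i + H₂ i)   ≡⟨ Σ<-+ b H₁ H₂ ⟩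
  Σ< b H₁ + Σ< b H₂          ≡⟨ cong (Σ< b H₁ +_) (Σ<-cong b (λ i _ → cong (𝟙 (lo ≤ᵇ i) *_)
                                  (exactSubsetSum-cong b m (suc i) (λ j → cong g (x∙yz≈y∙xz (suc i) (suc b) j))))) ⟩
  Σ< b H₁ + exactSubsetSum b (suc m) lo (λ j → g (suc b + j)) ∎
  where
  open ≡-Reasoning
  H H₁ H₂ : ℕ → ℕ
  H  i = 𝟙 (lo ≤ᵇ i) * exactSubsetSum (suc b) (suc m) (suc i) (λ j → g (suc i + j))
  H₁ i = 𝟙 (lo ≤ᵇ i) * exactSubsetSum b (suc m) (suc i) (λ j → g (suc i + j))
  H₂ i = 𝟙 (lo ≤ᵇ i) * exactSubsetSum b m (suc i) (λ j → g (suc i + (suc b + j)))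
  Hb≡0 : H b ≡ 0
  Hb≡0 = trans (cong (𝟙 (lo ≤ᵇ b) *_) (exactSubsetSum-tooLarge (suc b) m (suc b) (λ j → g (suc b + j))
                 (s≤s (≤-trans (s≤s (m≤m+n b m)) (≤-reflexive (sym (+-suc b m)))))))
               (*-zeroʳ (𝟙 (lo ≤ᵇ b)))
  split : ∀ i → i < b → H i ≡ H₁ i + H₂ i
  split i i<b = trans (cong (𝟙 (lo ≤ᵇ i) *_) (exactSubsetSum-suc b m (suc i) (λ j → g (suc i + j)) i<b))
                      (*-distribˡ-+ (𝟙 (lo ≤ᵇ i)) (exactSubsetSum b (suc m) (suc i) (λ j → g (suc i + j))) _)

boundedSubsetSum-suc : ∀ b m g →
  boundedSubsetSum (suc b) (suc m) g ≡
  boundedSubsetSum b (suc m) g + boundedSubsetSum b m (λ j → g (suc b + j))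
boundedSubsetSum-suc b zero g =
  trans (cong (g 0 +_) (exactSubsetSum-suc b zero 0 g z≤n)) (sym (+-assoc (g 0) _ _))
boundedSubsetSum-suc b (suc m) g =
  trans (cong₂ _+_ (boundedSubsetSum-suc b m g) (exactSubsetSum-suc b (suc m) 0 g z≤n))
        (interchange (boundedSubsetSum b (suc m) g) _ _ _)

boundedSubsetSum-saturated : ∀ b m g → b ≤ m → boundedSubsetSum b (suc m) g ≡ boundedSubsetSum b m g
boundedSubsetSum-saturated b m g b≤m =
  trans (cong (boundedSubsetSum b m g +_) (exactSubsetSum-tooLarge b m 0 g (s≤s b≤m)))
        (+-identityʳ _)

boundedSubsetSum-full : ∀ b g → boundedSubsetSum b b g ≡ subsetSum b g
boundedSubsetSum-full zero    g = refl
boundedSubsetSum-full (suc b) g = begin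
  boundedSubsetSum (suc b) (suc b) g
    ≡⟨ boundedSubsetSum-suc b b g ⟩
  boundedSubsetSum b (suc b) g + boundedSubsetSum b b (λ j → g (suc b + j))
    ≡⟨ cong (_+ boundedSubsetSum b b (λ j → g (suc b + j))) (boundedSubsetSum-saturated b b g ≤-refl) ⟩
  boundedSubsetSum b b g + boundedSubsetSum b b (λ j → g (suc b + j))
    ≡⟨ cong₂ _+_ (boundedSubsetSum-full b g) (boundedSubsetSum-full b (λ j → g (suc b + j))) ⟩
  subsetSum (suc b) g ∎
  where open ≡-Reasoning

-- The order on letters and the weights of words

T-∧ˡ : ∀ {x y} → T (x ∧ y) → T x
T-∧ˡ {true} _ = tt

T-∧ʳ : ∀ {x y} → T (x ∧ y) → T y
T-∧ʳ {true} p = p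

T-∧⁺ : ∀ {x y} → T x → T y → T (x ∧ y)
T-∧⁺ {true} _ q = q

T-not⁺ : ∀ {x} → ¬ T x → T (not x)
T-not⁺ {false} _ = tt
T-not⁺ {true}  p = p tt

T-not⁻ : ∀ {x} → T (not x) → ¬ T x
T-not⁻ {false} _ ()

≰ᵇ⇒> : ∀ m n → ¬ T (m ≤ᵇ n) → n < m
≰ᵇ⇒> m n m≰n = ≰⇒> (λ m≤n → m≰n (≤⇒≤ᵇ m≤n))

module _ {a b : ℕ} where

  ≼-refl : (x : Sym a b) → T (x ≼ᵇ x)
  ≼-refl (tl i) = ≤⇒≤ᵇ (≤-refl {toℕ i})
  ≼-refl zS     = tt
  ≼-refl (br j) = ≤⇒≤ᵇ (≤-refl {toℕ j})

  ≼-trans : (x y z : Sym a b) → T (x ≼ᵇ y) → T (y ≼ᵇ z) → T (x ≼ᵇ z)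
  ≼-trans (br i) (br j) (br k) p q = ≤⇒≤ᵇ (≤-trans (≤ᵇ⇒≤ (toℕ k) (toℕ j) q) (≤ᵇ⇒≤ (toℕ j) (toℕ i) p))
  ≼-trans (br _) _      zS     _ _ = tt
  ≼-trans (br _) _      (tl _) _ _ = tt
  ≼-trans (br _) zS     (br _) _ ()
  ≼-trans (br _) (tl _) (br _) _ ()
  ≼-trans zS     zS     _      _ q = q
  ≼-trans zS     (tl _) zS     _ ()
  ≼-trans zS     (tl _) (tl _) _ _ = tt
  ≼-trans zS     (tl _) (br _) _ ()
  ≼-trans zS     (br _) _      () _
  ≼-trans (tl i) (tl j) (tl k) p q = ≤⇒≤ᵇ (≤-trans (≤ᵇ⇒≤ (toℕ i) (toℕ j) p) (≤ᵇ⇒≤ (toℕ j) (toℕ k) q))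
  ≼-trans (tl _) (tl _) zS     _ ()
  ≼-trans (tl _) (tl _) (br _) _ ()
  ≼-trans (tl _) zS     _      () _
  ≼-trans (tl _) (br _) _      () _

  ≼-≺-trans : (x y z : Sym a b) → T (x ≼ᵇ y) → T (y ≺ᵇ z) → T (x ≺ᵇ z)
  ≼-≺-trans x y z x≼y y≺z = T-∧⁺ (≼-trans x y z x≼y (T-∧ˡ {y ≼ᵇ z} y≺z))
    (T-not⁺ (λ z≼x → T-not⁻ {z ≼ᵇ y} (T-∧ʳ {y ≼ᵇ z} y≺z) (≼-trans z x y z≼x x≼y)))

  vle-refl : ∀ {m} (v : Vec (Sym a b) m) → T (vle v v)
  vle-refl []       = tt
  vle-refl (x ∷ v) = T-∧⁺ (≼-refl x) (vle-refl v)

  validL-head : ∀ {m} x (xs : Vec (Sym a b) m) → T (validL (x ∷ xs)) → T (not (isBar x))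
  validL-head x []      p = p
  validL-head x (_ ∷ _) p = T-∧ˡ {not (isBar x)} p

  validL-tail : ∀ {m} x (xs : Vec (Sym a b) m) → T (validL (x ∷ xs)) → T (validL xs)
  validL-tail x []      _ = tt
  validL-tail x (_ ∷ _) p = T-∧ʳ (T-∧ʳ {not (isBar x)} p)

  validR-head : ∀ {m} x (xs : Vec (Sym a b) m) → T (validR (x ∷ xs)) → T (not (isTilde x))
  validR-head x []      p = p
  validR-head x (_ ∷ _) p = T-∧ˡ {not (isTilde x)} p

  validR-tail : ∀ {m} x (xs : Vec (Sym a b) m) → T (validR (x ∷ xs)) → T (validR xs)
  validR-tail x []      _ = tt
  validR-tail x (_ ∷ _) p = T-∧ʳ (T-∧ʳ {not (isTilde x)} p)

  -- tl i and br j weigh i + 1 and j + 1, i.e. the index of the letter in the paper.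
  tildeWeight : Sym a b → ℕ
  tildeWeight (tl i) = suc (toℕ i)
  tildeWeight zS     = 0
  tildeWeight (br _) = 0

  barWeight : Sym a b → ℕ
  barWeight (tl _) = 0
  barWeight zS     = 0
  barWeight (br j) = suc (toℕ j)

  leftWeight : ∀ {m} → Vec (Sym a b) m → ℕ
  leftWeight []       = 0
  leftWeight (x ∷ xs) = tildeWeight x + leftWeight xs

  rightWeight : ∀ {m} → Vec (Sym a b) m → ℕ
  rightWeight []       = 0
  rightWeight (x ∷ xs) = barWeight x + rightWeight xs

  tildeWeight-mono : (y x : Sym a b) → T (y ≼ᵇ x) → tildeWeight y ≤ tildeWeight x
  tildeWeight-mono (tl i) (tl j) p = s≤s (≤ᵇ⇒≤ (toℕ i) (toℕ j) p)
  tildeWeight-mono (tl _) zS     ()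
  tildeWeight-mono (tl _) (br _) ()
  tildeWeight-mono zS     _      _ = z≤n
  tildeWeight-mono (br _) _      _ = z≤n

  tildeWeight-strict : (y x : Sym a b) → T (not (isBar y)) → T (y ≼ᵇ x) → ¬ T (x ≼ᵇ y) →
                       tildeWeight y < tildeWeight x
  tildeWeight-strict zS     (tl _) _ _ _  = z<s
  tildeWeight-strict zS     zS     _ _ x⋠y = ⊥-elim (x⋠y tt)
  tildeWeight-strict zS     (br _) _ () _
  tildeWeight-strict (tl i) (tl j) _ _ x⋠y = s≤s (≰ᵇ⇒> (toℕ j) (toℕ i) x⋠y)
  tildeWeight-strict (tl _) zS     _ () _
  tildeWeight-strict (tl _) (br _) _ () _
  tildeWeight-strict (br _) _      () _ _

  barWeight-antitone : (y x : Sym a b) → T (y ≼ᵇ x) → barWeight x ≤ barWeight y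
  barWeight-antitone (br i) (br j) p = s≤s (≤ᵇ⇒≤ (toℕ j) (toℕ i) p)
  barWeight-antitone (br _) zS     _ = z≤n
  barWeight-antitone (br _) (tl _) _ = z≤n
  barWeight-antitone zS     (br _) ()
  barWeight-antitone zS     zS     _ = z≤n
  barWeight-antitone zS     (tl _) _ = z≤n
  barWeight-antitone (tl _) (tl _) _ = z≤n
  barWeight-antitone (tl _) zS     ()
  barWeight-antitone (tl _) (br _) ()

  barWeight-strict : (y x : Sym a b) → T (not (isTilde x)) → T (y ≼ᵇ x) → ¬ T (x ≼ᵇ y) →
                     barWeight x < barWeight y
  barWeight-strict (br _) zS     _ _ _  = z<s
  barWeight-strict zS     zS     _ _ x⋠y = ⊥-elim (x⋠y tt)
  barWeight-strict (tl _) zS     _ () _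
  barWeight-strict (br i) (br j) _ _ x⋠y = s≤s (≰ᵇ⇒> (toℕ i) (toℕ j) x⋠y)
  barWeight-strict zS     (br _) _ () _
  barWeight-strict (tl _) (br _) _ () _
  barWeight-strict _      (tl _) () _ _

  leftWeight-mono : ∀ {m} (u′ u : Vec (Sym a b) m) → T (vle u′ u) → leftWeight u′ ≤ leftWeight u
  leftWeight-mono []       []       _ = z≤n
  leftWeight-mono (y ∷ ys) (x ∷ xs) p =
    +-mono-≤ (tildeWeight-mono y x (T-∧ˡ {y ≼ᵇ x} p)) (leftWeight-mono ys xs (T-∧ʳ {y ≼ᵇ x} p))

  leftWeight-strict : ∀ {m} (u′ u : Vec (Sym a b) m) → T (validL u′) → T (vle u′ u) → ¬ T (vle u u′) →
                      leftWeight u′ < leftWeight u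
  leftWeight-strict []       []       _ _ u⋠u′ = ⊥-elim (u⋠u′ tt)
  leftWeight-strict (y ∷ ys) (x ∷ xs) valid p u⋠u′ with x ≼ᵇ y in x≼y
  ... | true  = +-mono-≤-< (tildeWeight-mono y x (T-∧ˡ {y ≼ᵇ x} p))
                  (leftWeight-strict ys xs (validL-tail y ys valid) (T-∧ʳ {y ≼ᵇ x} p) u⋠u′)
  ... | false = +-mono-<-≤ (tildeWeight-strict y x (validL-head y ys valid) (T-∧ˡ {y ≼ᵇ x} p) (subst T x≼y))
                  (leftWeight-mono ys xs (T-∧ʳ {y ≼ᵇ x} p))

  rightWeight-antitone : ∀ {m} (v′ v : Vec (Sym a b) m) → T (vle v′ v) → rightWeight v ≤ rightWeight v′
  rightWeight-antitone []       []       _ = z≤n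
  rightWeight-antitone (y ∷ ys) (x ∷ xs) p =
    +-mono-≤ (barWeight-antitone y x (T-∧ˡ {y ≼ᵇ x} p)) (rightWeight-antitone ys xs (T-∧ʳ {y ≼ᵇ x} p))

  rightWeight-strict : ∀ {m} (v′ v : Vec (Sym a b) m) → T (validR v) → T (vle v′ v) → ¬ T (vle v v′) →
                       rightWeight v < rightWeight v′
  rightWeight-strict []       []       _ _ v⋠v′ = ⊥-elim (v⋠v′ tt)
  rightWeight-strict (y ∷ ys) (x ∷ xs) valid p v⋠v′ with x ≼ᵇ y in x≼y
  ... | true  = +-mono-≤-< (barWeight-antitone y x (T-∧ˡ {y ≼ᵇ x} p))
                  (rightWeight-strict ys xs (validR-tail x xs valid) (T-∧ʳ {y ≼ᵇ x} p) v⋠v′)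
  ... | false = +-mono-<-≤ (barWeight-strict y x (validR-head x xs valid) (T-∧ˡ {y ≼ᵇ x} p) (subst T x≼y))
                  (rightWeight-antitone ys xs (T-∧ʳ {y ≼ᵇ x} p))

-- Lowering a word by one unit of weight

∸≡suc∸suc : ∀ {m n} → n < m → m ∸ n ≡ suc (m ∸ suc n)
∸≡suc∸suc n<m = +-∸-assoc 1 n<m

0<∸⇒< : ∀ {m n} → 0 < m ∸ n → n < m
0<∸⇒< 0<m∸n = m∸n≢0⇒n<m (λ m∸n≡0 → <⇒≢ 0<m∸n (sym m∸n≡0))

-- b + (b - 1) + … + (b - m + 1), the largest weight of a valid right word of length m
maxRightWeight : ℕ → ℕ → ℕ
maxRightWeight b zero    = 0
maxRightWeight b (suc m) = (b ∸ m) + maxRightWeight b m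

maxRightWeight+tri : ∀ b m → m ≤ b → maxRightWeight b m + tri (b ∸ m) ≡ tri b
maxRightWeight+tri b zero    _   = refl
maxRightWeight+tri b (suc m) m<b = begin
  (b ∸ m + M) + tri (b ∸ suc m)    ≡⟨ cong (_+ tri (b ∸ suc m)) (+-comm (b ∸ m) M) ⟩
  (M + (b ∸ m)) + tri (b ∸ suc m)  ≡⟨ +-assoc M (b ∸ m) (tri (b ∸ suc m)) ⟩
  M + ((b ∸ m) + tri (b ∸ suc m))  ≡⟨ cong (M +_) peel ⟩
  M + tri (b ∸ m)                  ≡⟨ maxRightWeight+tri b m (<⇒≤ m<b) ⟩
  tri b                            ∎
  where
  open ≡-Reasoning
  M = maxRightWeight b m
  peel : (b ∸ m) + tri (b ∸ suc m) ≡ tri (b ∸ m)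
  peel = subst (λ c → c + tri (b ∸ suc m) ≡ tri c) (sym (∸≡suc∸suc m<b)) refl

maxRightWeight-full : ∀ b → maxRightWeight b b ≡ tri b
maxRightWeight-full b = begin
  maxRightWeight b b                      ≡⟨ sym (+-identityʳ _) ⟩
  maxRightWeight b b + tri 0              ≡⟨ cong (λ c → maxRightWeight b b + tri c) (sym (n∸n≡0 b)) ⟩
  maxRightWeight b b + tri (b ∸ b)        ≡⟨ maxRightWeight+tri b b ≤-refl ⟩
  tri b                                   ∎
  where open ≡-Reasoning

module _ {a b : ℕ} where

  validR-bar-bound : ∀ {m} (j : Fin b) (xs : Vec (Sym a b) m) → T (validR (br j ∷ xs)) →
                     suc (toℕ j) + m ≤ b
  validR-bar-bound j []          _ = subst (_≤ b) (sym (+-identityʳ (suc (toℕ j)))) (toℕ<n j)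
  validR-bar-bound {suc m} j (br i ∷ ys) valid = begin
    suc (toℕ j) + suc m  ≡⟨ +-suc (suc (toℕ j)) m ⟩
    suc (suc (toℕ j)) + m ≤⟨ +-monoˡ-≤ m (s≤s j<i) ⟩
    suc (toℕ i) + m      ≤⟨ validR-bar-bound i ys (T-∧ʳ {br {a} i ≺ᵇ br j} valid) ⟩
    b                    ∎
    where
    open ≤-Reasoning
    j<i : toℕ j < toℕ i
    j<i = ≰ᵇ⇒> (toℕ i) (toℕ j)
            (T-not⁻ {toℕ i ≤ᵇ toℕ j} (T-∧ʳ {toℕ j ≤ᵇ toℕ i} (T-∧ˡ {br {a} i ≺ᵇ br j} valid)))
  validR-bar-bound j (zS ∷ _)   ()
  validR-bar-bound j (tl _ ∷ _) ()

  barWeight-bound : ∀ {m} x (xs : Vec (Sym a b) m) → T (validR (x ∷ xs)) → barWeight x ≤ b ∸ m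
  barWeight-bound (tl _) _ _     = z≤n
  barWeight-bound zS     _ _     = z≤n
  barWeight-bound (br j) xs valid = m+n≤o⇒m≤o∸n (suc (toℕ j)) (validR-bar-bound j xs valid)

  rightWeight-bound : ∀ {m} (v : Vec (Sym a b) m) → T (validR v) → rightWeight v ≤ maxRightWeight b m
  rightWeight-bound []       _     = z≤n
  rightWeight-bound (x ∷ xs) valid =
    +-mono-≤ (barWeight-bound x xs valid) (rightWeight-bound xs (validR-tail x xs valid))

  rightWeight-tight-head : ∀ {m} y (ys : Vec (Sym a b) m) → T (validR (y ∷ ys)) →
                           maxRightWeight b (suc m) ≤ rightWeight (y ∷ ys) → b ∸ m ≤ barWeight y
  rightWeight-tight-head {m} y ys valid tight = +-cancelʳ-≤ (maxRightWeight b m) (b ∸ m) (barWeight y)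
    (≤-trans tight (+-monoʳ-≤ (barWeight y) (rightWeight-bound ys (validR-tail y ys valid))))

  validR-∷-lower : ∀ {m} x (v v′ : Vec (Sym a b) m) → T (validR (x ∷ v)) → T (validR v′) →
                   T (vle v′ v) → T (validR (x ∷ v′))
  validR-∷-lower x      []      []        valid _      _ = valid
  validR-∷-lower (tl _) (_ ∷ _) (_ ∷ _)   ()    _      _
  validR-∷-lower zS     (_ ∷ _) (_ ∷ _)   _     valid′ _ = valid′
  validR-∷-lower (br j) (y ∷ _) (y′ ∷ _) valid valid′ v′≤v =
    T-∧⁺ (≼-≺-trans y′ y (br j) (T-∧ˡ {y′ ≼ᵇ y} v′≤v) (T-∧ˡ {y ≺ᵇ br j} valid)) valid′

  validL-∷-lower : ∀ {m} x (u u′ : Vec (Sym a b) m) → T (validL (x ∷ u)) → T (validL u′) →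
                   T (vle u′ u) → T (validL (x ∷ u′))
  validL-∷-lower x      []         []        valid _      _ = valid
  validL-∷-lower (br _) (_ ∷ _)    _         ()    _      _
  validL-∷-lower zS     (zS ∷ _)   (y′ ∷ ys′) _    valid′ u′≤u =
    T-∧⁺ (below-zS y′ (T-∧ˡ {y′ ≼ᵇ zS} u′≤u) (validL-head y′ ys′ valid′)) valid′
    where
    below-zS : ∀ y → T (y ≼ᵇ zS) → T (not (isBar y)) → T (isZ y)
    below-zS zS     _  _  = tt
    below-zS (tl _) () _
    below-zS (br _) _  ()
  validL-∷-lower zS     (tl _ ∷ _) _         ()    _      _
  validL-∷-lower zS     (br _ ∷ _) _         ()    _      _
  validL-∷-lower (tl i) (y ∷ _)    (y′ ∷ _)  valid valid′ u′≤u =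
    T-∧⁺ (≼-≺-trans y′ y (tl i) (T-∧ˡ {y′ ≼ᵇ y} u′≤u) (T-∧ˡ {y ≺ᵇ tl i} valid)) valid′

  LowerLeft : ∀ {m} → Vec (Sym a b) m → Set
  LowerLeft {m} u = Σ[ u′ ∈ Vec (Sym a b) m ]
    T (validL u′) × T (vle u′ u) × ¬ T (vle u u′) × suc (leftWeight u′) ≡ leftWeight u

  -- Lowering a right word raises its bar weight.
  LowerRight : ∀ {m} → Vec (Sym a b) m → Set
  LowerRight {m} v = Σ[ v′ ∈ Vec (Sym a b) m ]
    T (validR v′) × T (vle v′ v) × ¬ T (vle v v′) × rightWeight v′ ≡ suc (rightWeight v)

  lowerLeft-∷ : ∀ {m} x (xs : Vec (Sym a b) m) → T (validL (x ∷ xs)) → LowerLeft xs → LowerLeft (x ∷ xs)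
  lowerLeft-∷ x xs valid (xs′ , valid′ , xs′≤xs , xs⋠xs′ , eq) =
    x ∷ xs′ , validL-∷-lower x xs xs′ valid valid′ xs′≤xs , T-∧⁺ (≼-refl x) xs′≤xs ,
    (λ p → xs⋠xs′ (T-∧ʳ {x ≼ᵇ x} p)) ,
    trans (sym (+-suc (tildeWeight x) (leftWeight xs′))) (cong (tildeWeight x +_) eq)

  lowerRight-∷ : ∀ {m} x (xs : Vec (Sym a b) m) → T (validR (x ∷ xs)) → LowerRight xs → LowerRight (x ∷ xs)
  lowerRight-∷ x xs valid (xs′ , valid′ , xs′≤xs , xs⋠xs′ , eq) =
    x ∷ xs′ , validR-∷-lower x xs xs′ valid valid′ xs′≤xs , T-∧⁺ (≼-refl x) xs′≤xs ,
    (λ p → xs⋠xs′ (T-∧ʳ {x ≼ᵇ x} p)) ,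
    trans (cong (barWeight x +_) eq) (+-suc (barWeight x) (rightWeight xs))

  tildePred : Fin a → Sym a b
  tildePred fzero    = zS
  tildePred (fsuc i) = tl (inject₁ i)

  tildePred≺ : ∀ i → T (tildePred i ≼ᵇ tl i) × ¬ T (tl i ≼ᵇ tildePred i)
  tildePred≺ fzero    = tt , λ ()
  tildePred≺ (fsuc i) =
    ≤⇒≤ᵇ (≤-trans (≤-reflexive (toℕ-inject₁ i)) (n≤1+n _)) ,
    λ p → 1+n≰n (≤-trans (≤ᵇ⇒≤ (suc (toℕ i)) (toℕ (inject₁ i)) p) (≤-reflexive (toℕ-inject₁ i)))

  tildeWeight-tildePred : ∀ i → suc (tildeWeight (tildePred i)) ≡ tildeWeight (tl {b = b} i)
  tildeWeight-tildePred fzero    = refl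
  tildeWeight-tildePred (fsuc i) = cong (λ c → suc (suc c)) (toℕ-inject₁ i)

  -- The tail has weight 0, so it consists of 0^§ only, and any non-bar may precede it.
  lowerLeft-head : ∀ {m} i (xs : Vec (Sym a b) m) → T (validL (tl i ∷ xs)) → leftWeight xs ≡ 0 →
                   LowerLeft (tl i ∷ xs)
  lowerLeft-head i xs valid xs≡0 =
    tildePred i ∷ xs , valid′ i xs valid xs≡0 , T-∧⁺ (proj₁ (tildePred≺ i)) (vle-refl xs) ,
    (λ p → proj₂ (tildePred≺ i) (T-∧ˡ {tl i ≼ᵇ tildePred i} p)) ,
    cong (_+ leftWeight xs) (tildeWeight-tildePred i)
    where
    valid′ : ∀ {m} i (xs : Vec (Sym a b) m) → T (validL (tl i ∷ xs)) → leftWeight xs ≡ 0 →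
             T (validL (tildePred i ∷ xs))
    valid′ fzero    []          _ _ = tt
    valid′ (fsuc _) []          _ _ = tt
    valid′ i        (tl _ ∷ _)  _ ()
    valid′ i        (br j ∷ ys) p _ = ⊥-elim (validL-head (br j) ys (validL-tail (tl i) (br j ∷ ys) p))
    valid′ fzero    (zS ∷ ys)   p _ = validL-tail (tl fzero) (zS ∷ ys) p
    valid′ (fsuc i) (zS ∷ ys)   p _ = validL-tail (tl (fsuc i)) (zS ∷ ys) p

  lowerLeft : ∀ {m} (u : Vec (Sym a b) m) → T (validL u) → 0 < leftWeight u → LowerLeft u
  lowerLeft []       _     ()
  lowerLeft (x ∷ xs) valid 0<u with 0 <? leftWeight xs
  ... | yes 0<xs = lowerLeft-∷ x xs valid (lowerLeft xs (validL-tail x xs valid) 0<xs)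
  ... | no  0≮xs = lowerHead x valid 0<u (n≤0⇒n≡0 (≮⇒≥ 0≮xs))
    where
    lowerHead : ∀ x → T (validL (x ∷ xs)) → 0 < tildeWeight x + leftWeight xs → leftWeight xs ≡ 0 →
                LowerLeft (x ∷ xs)
    lowerHead (tl i) valid _   xs≡0 = lowerLeft-head i xs valid xs≡0
    lowerHead zS     _     0<u xs≡0 = ⊥-elim (<-irrefl refl (subst (0 <_) xs≡0 0<u))
    lowerHead (br _) _     0<u xs≡0 = ⊥-elim (<-irrefl refl (subst (0 <_) xs≡0 0<u))

  ≺-bar : ∀ (k : Fin b) (y : Sym a b) → suc (suc (toℕ k)) ≤ barWeight y → T (y ≺ᵇ br k)
  ≺-bar k (br i) (s≤s k<i) =
    T-∧⁺ (≤⇒≤ᵇ (<⇒≤ k<i)) (T-not⁺ (λ i≤k → <⇒≱ k<i (≤ᵇ⇒≤ (toℕ i) (toℕ k) i≤k)))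
  ≺-bar k zS     ()
  ≺-bar k (tl _) ()

  bar-below : ∀ (x : Sym a b) (x<b : barWeight x < b) → T (not (isTilde x)) → T (br (fromℕ< x<b) ≼ᵇ x)
  bar-below zS     _   _  = tt
  bar-below (br j) x<b _  = ≤⇒≤ᵇ (subst (toℕ j ≤_) (sym (toℕ-fromℕ< x<b)) (n≤1+n (toℕ j)))
  bar-below (tl _) _   ()

  bar-below-strict : ∀ (x : Sym a b) (x<b : barWeight x < b) → ¬ T (x ≼ᵇ br (fromℕ< x<b))
  bar-below-strict zS     _   ()
  bar-below-strict (tl _) _   ()
  bar-below-strict (br j) x<b p =
    1+n≰n (subst (_≤ toℕ j) (toℕ-fromℕ< x<b) (≤ᵇ⇒≤ (toℕ (fromℕ< x<b)) (toℕ j) p))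

  validR-barHead : ∀ {m} (k : Fin b) (xs : Vec (Sym a b) m) → T (validR xs) →
                   maxRightWeight b m ≤ rightWeight xs → suc (toℕ k) ≤ b ∸ m → T (validR (br k ∷ xs))
  validR-barHead k []                _     _     _  = tt
  validR-barHead {suc m} k (y ∷ ys) valid tight k< = T-∧⁺ (≺-bar k y (begin
    suc (suc (toℕ k))  ≤⟨ s≤s k< ⟩
    suc (b ∸ suc m)    ≡⟨ sym (∸≡suc∸suc m<b) ⟩
    b ∸ m              ≤⟨ rightWeight-tight-head y ys valid tight ⟩
    barWeight y        ∎)) valid
    where
    open ≤-Reasoning
    m<b : m < b
    m<b = <-trans (n<1+n m) (0<∸⇒< (≤-trans (s≤s z≤n) k<))

  -- The tail has maximal weight, so only the head can be lowered: replace it by the bar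
  -- of index barWeight x + 1.
  lowerRight-head : ∀ {m} x (xs : Vec (Sym a b) m) → T (validR (x ∷ xs)) →
                    maxRightWeight b m ≤ rightWeight xs → barWeight x < b ∸ m → LowerRight (x ∷ xs)
  lowerRight-head {m} x xs valid tight x<b∸m =
    br k ∷ xs ,
    validR-barHead k xs (validR-tail x xs valid) tight
      (subst (λ c → suc c ≤ b ∸ m) (sym (toℕ-fromℕ< x<b)) x<b∸m) ,
    T-∧⁺ (bar-below x x<b (validR-head x xs valid)) (vle-refl xs) ,
    (λ p → bar-below-strict x x<b (T-∧ˡ {x ≼ᵇ br k} p)) ,
    cong (λ c → suc c + rightWeight xs) (toℕ-fromℕ< x<b)
    where
    x<b : barWeight x < b
    x<b = <-≤-trans x<b∸m (m∸n≤m b m)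
    k : Fin b
    k = fromℕ< x<b

  lowerRight : ∀ {m} (v : Vec (Sym a b) m) → T (validR v) → rightWeight v < maxRightWeight b m →
               LowerRight v
  lowerRight []       _ ()
  lowerRight {suc m} (x ∷ xs) valid v<max with rightWeight xs <? maxRightWeight b m
  ... | yes xs<max = lowerRight-∷ x xs valid (lowerRight xs (validR-tail x xs valid) xs<max)
  ... | no  xs≮max = lowerRight-head x xs valid tight
                       (+-cancelʳ-< (maxRightWeight b m) (barWeight x) (b ∸ m)
                         (≤-<-trans (+-monoʳ-≤ (barWeight x) tight) v<max))
    where
    tight : maxRightWeight b m ≤ rightWeight xs
    tight = ≮⇒≥ xs≮max

-- The rank function of S(n,r)

-- tri b ∸ rightWeight v is the total index of the bars missing from v.
weight : ∀ {n r} → Str n r → ℕ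
weight {n} {r} (u , v) = leftWeight u + (tri (n ∸ r) ∸ rightWeight v)

module _ {n r : ℕ} where

  <S-left : (u u′ : Vec (Sym r (n ∸ r)) r) (v : Vec (Sym r (n ∸ r)) (n ∸ r)) →
            T (vle u′ u) → ¬ T (vle u u′) → T (_<S_ {n} {r} (u′ , v) (u , v))
  <S-left u u′ v u′≤u u⋠u′ = T-∧⁺ (T-∧⁺ {vle u′ u} u′≤u (vle-refl v))
    (T-not⁺ (λ p → u⋠u′ (T-∧ʳ {vle u′ u} (T-∧ˡ {veq u′ u} p))))

  <S-right : (u : Vec (Sym r (n ∸ r)) r) (v v′ : Vec (Sym r (n ∸ r)) (n ∸ r)) →
             T (vle v′ v) → ¬ T (vle v v′) → T (_<S_ {n} {r} (u , v′) (u , v))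
  <S-right u v v′ v′≤v v⋠v′ = T-∧⁺ (T-∧⁺ {vle u u} (vle-refl u) v′≤v)
    (T-not⁺ (λ p → v⋠v′ (T-∧ʳ {vle v′ v} (T-∧ʳ {veq u u} p))))

  weight-strictMono : (x y : Str n r) → T (isS x) → T (isS y) → T (y <S x) → weight y < weight x
  weight-strictMono (u , v) (u′ , v′) valid valid′ y<x with T? (vle u u′)
  ... | no  u⋠u′ = +-mono-<-≤ (leftWeight-strict u′ u (T-∧ˡ {validL u′} valid′) u′≤u u⋠u′)
                              (∸-monoʳ-≤ (tri (n ∸ r)) (rightWeight-antitone v′ v v′≤v))
    where
    u′≤u = T-∧ˡ {vle u′ u} (T-∧ˡ {vle u′ u ∧ vle v′ v} y<x)
    v′≤v = T-∧ʳ {vle u′ u} (T-∧ˡ {vle u′ u ∧ vle v′ v} y<x)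
  ... | yes u≤u′ = +-mono-≤-< (leftWeight-mono u′ u u′≤u)
      (∸-monoʳ-< (rightWeight-strict v′ v (T-∧ʳ {validL u} valid) v′≤v v⋠v′)
                 (≤-trans (rightWeight-bound v′ (T-∧ʳ {validL u′} valid′))
                          (≤-reflexive (maxRightWeight-full (n ∸ r)))))
    where
    u′≤u = T-∧ˡ {vle u′ u} (T-∧ˡ {vle u′ u ∧ vle v′ v} y<x)
    v′≤v = T-∧ʳ {vle u′ u} (T-∧ˡ {vle u′ u ∧ vle v′ v} y<x)
    v⋠v′ : ¬ T (vle v v′)
    v⋠v′ v≤v′ = T-not⁻ {veq u′ u ∧ veq v′ v} (T-∧ʳ {vle u′ u ∧ vle v′ v} y<x)
                  (T-∧⁺ {veq u′ u} (T-∧⁺ {vle u′ u} u′≤u u≤u′) (T-∧⁺ {vle v′ v} v′≤v v≤v′))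

  weight-lower : (x : Str n r) → T (isS x) → 0 < weight x →
                 Σ[ y ∈ Str n r ] T (isS y) × T (y <S x) × suc (weight y) ≡ weight x
  weight-lower (u , v) valid 0<x with 0 <? leftWeight u
  ... | yes 0<u =
    let (u′ , valid′ , u′≤u , u⋠u′ , eq) = lowerLeft u (T-∧ˡ {validL u} valid) 0<u
    in (u′ , v) , T-∧⁺ {validL u′} valid′ (T-∧ʳ {validL u} valid) , <S-left u u′ v u′≤u u⋠u′ ,
       cong (_+ (tri (n ∸ r) ∸ rightWeight v)) eq
  ... | no 0≮u =
    let (v′ , valid′ , v′≤v , v⋠v′ , eq) = lowerRight v (T-∧ʳ {validL u} valid)
                                             (subst (rightWeight v <_) (sym (maxRightWeight-full b)) v<tri)
    in (u , v′) , T-∧⁺ {validL u} (T-∧ˡ {validL u} valid) valid′ , <S-right u v v′ v′≤v v⋠v′ , (begin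
      suc (leftWeight u + (tri b ∸ rightWeight v′))  ≡⟨ sym (+-suc (leftWeight u) _) ⟩
      leftWeight u + suc (tri b ∸ rightWeight v′)    ≡⟨ cong (λ c → leftWeight u + suc (tri b ∸ c)) eq ⟩
      leftWeight u + suc (tri b ∸ suc (rightWeight v)) ≡⟨ cong (leftWeight u +_) (sym (∸≡suc∸suc v<tri)) ⟩
      leftWeight u + (tri b ∸ rightWeight v)         ∎)
    where
    open ≡-Reasoning
    b = n ∸ r
    v<tri : rightWeight v < tri b
    v<tri = 0<∸⇒< (subst (λ c → 0 < c + (tri b ∸ rightWeight v)) (n≤0⇒n≡0 (≮⇒≥ 0≮u)) 0<x)

allVecs-complete : ∀ (xs : List A) → (∀ x → x ∈ xs) → ∀ {m} (v : Vec A m) → v ∈ allVecs xs m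
allVecs-complete xs complete []             = here refl
allVecs-complete xs complete {suc m} (x ∷ v) =
  ∈-concatMap⁺ (λ y → map (y ∷_) (allVecs xs m))
    (mapAny (λ { refl → ∈-map⁺ (x ∷_) (allVecs-complete xs complete v) }) (complete x))

allSym-complete : ∀ {a b} (x : Sym a b) → x ∈ allSym a b
allSym-complete {a} (tl i) = ∈-++⁺ˡ (∈-map⁺ tl (∈-allFin i))
allSym-complete {a} zS     = ∈-++⁺ʳ (map tl (allFin a)) (here refl)
allSym-complete {a} (br j) = ∈-++⁺ʳ (map tl (allFin a)) (there (∈-map⁺ br (∈-allFin j)))

maxL-lub : ∀ (xs : List ℕ) c → (∀ z → z ∈ xs → z ≤ c) → maxL xs ≤ c
maxL-lub []       c _  = z≤n
maxL-lub (x ∷ xs) c ub = ⊔-lub (ub x (here refl)) (maxL-lub xs c (λ z z∈xs → ub z (there z∈xs)))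

≤-maxL : ∀ (xs : List ℕ) z → z ∈ xs → z ≤ maxL xs
≤-maxL (x ∷ xs) z (here refl) = m≤m⊔n x (maxL xs)
≤-maxL (x ∷ xs) z (there z∈xs) = ≤-trans (≤-maxL xs z z∈xs) (m≤n⊔m x (maxL xs))

module _ {n r : ℕ} where

  private
    candidates : List (Str n r)
    candidates = concatMap (λ u → map (u ,_) (allVecs (allSym r (n ∸ r)) (n ∸ r)))
                           (allVecs (allSym r (n ∸ r)) r)

  ∈-elems⁺ : (x : Str n r) → T (isS x) → x ∈ elems n r
  ∈-elems⁺ (u , v) valid = ∈-filter⁺ (λ w → T? (isS w))
    (∈-concatMap⁺ (λ u′ → map (u′ ,_) (allVecs (allSym r (n ∸ r)) (n ∸ r)))
      (mapAny (λ { refl → ∈-map⁺ (u ,_) (allVecs-complete _ allSym-complete v) })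
              (allVecs-complete _ allSym-complete u)))
    valid

  ∈-elems⁻ : (x : Str n r) → x ∈ elems n r → T (isS x)
  ∈-elems⁻ x x∈ = proj₂ (∈-filter⁻ (λ w → T? (isS w)) {xs = candidates} x∈)

  height≤weight : ∀ f (x : Str n r) → T (isS x) → height f x ≤ weight x
  height≤weight zero    x _     = z≤n
  height≤weight (suc f) x valid = maxL-lub _ (weight x) bound
    where
    bound : ∀ z → z ∈ map (λ y → suc (height f y)) (filter (λ y → T? (y <S x)) (elems n r)) →
            z ≤ weight x
    bound z z∈ with ∈-map⁻ (λ y → suc (height f y)) z∈
    ... | y , y∈ , refl with ∈-filter⁻ (λ y → T? (y <S x)) {xs = elems n r} y∈
    ...   | y∈elems , y<x = ≤-trans (s≤s (height≤weight f y (∈-elems⁻ y y∈elems)))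
                                    (weight-strictMono x y valid (∈-elems⁻ y y∈elems) y<x)

  weight≤height : ∀ f (x : Str n r) → T (isS x) → weight x ≤ f → weight x ≤ height f x
  weight≤height f x valid x≤f with 0 <? weight x
  ... | no  0≮x = ≤-trans (≮⇒≥ 0≮x) z≤n
  weight≤height zero    x valid x≤f | yes 0<x = ⊥-elim (<-irrefl refl (<-≤-trans 0<x x≤f))
  weight≤height (suc f) x valid x≤f | yes 0<x with weight-lower x valid 0<x
  ... | y , valid′ , y<x , eq = begin
    weight x            ≡⟨ sym eq ⟩
    suc (weight y)      ≤⟨ s≤s (weight≤height f y valid′ (≤-pred (subst (_≤ suc f) (sym eq) x≤f))) ⟩
    suc (height f y)    ≤⟨ ≤-maxL _ _ (∈-map⁺ (λ y → suc (height f y))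
                             (∈-filter⁺ (λ y → T? (y <S x)) (∈-elems⁺ y valid′) y<x)) ⟩
    height (suc f) x    ∎
    where open ≤-Reasoning

  weight-downClosed : ∀ k (x : Str n r) → T (isS x) → weight x ≡ k →
                      ∀ j → j ≤ k → Σ[ y ∈ Str n r ] T (isS y) × weight y ≡ j
  weight-downClosed k x valid x≡k j j≤k with j ≟ k
  ... | yes j≡k = x , valid , trans x≡k (sym j≡k)
  weight-downClosed zero    x valid x≡k j j≤k | no j≢k = ⊥-elim (j≢k (n≤0⇒n≡0 j≤k))
  weight-downClosed (suc k) x valid x≡k j j≤k | no j≢k with weight-lower x valid (subst (0 <_) (sym x≡k) z<s)
  ... | y , valid′ , _ , eq = weight-downClosed k y valid′ (suc-injective (trans eq x≡k)) j
                                (≤-pred (≤∧≢⇒< j≤k j≢k))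

  -- Elements of every weight 0, …, weight x exist, and they are pairwise distinct.
  weight≤length : (x : Str n r) → T (isS x) → weight x ≤ length (elems n r)
  weight≤length x valid = ≮⇒≥ λ L<x →
    let (i , j , i<j , same) = pigeonhole (m<n⇒m<1+n L<x) position
    in <⇒≢ i<j (begin
      toℕ i                            ≡⟨ sym (proj₂ (proj₂ (level i))) ⟩
      weight (proj₁ (level i))         ≡⟨ cong weight (lookup-index (witness i)) ⟩
      weight (lookup (elems n r) (position i)) ≡⟨ cong (λ p → weight (lookup (elems n r) p)) same ⟩
      weight (lookup (elems n r) (position j)) ≡⟨ cong weight (sym (lookup-index (witness j))) ⟩
      weight (proj₁ (level j))         ≡⟨ proj₂ (proj₂ (level j)) ⟩
      toℕ j                            ∎)
    where
    open ≡-Reasoning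
    level : (i : Fin (suc (weight x))) → Σ[ y ∈ Str n r ] T (isS y) × weight y ≡ toℕ i
    level i = weight-downClosed (weight x) x valid refl (toℕ i) (≤-pred (toℕ<n i))
    witness : (i : Fin (suc (weight x))) → proj₁ (level i) ∈ elems n r
    witness i = ∈-elems⁺ (proj₁ (level i)) (proj₁ (proj₂ (level i)))
    position : Fin (suc (weight x)) → Fin (length (elems n r))
    position i = index (witness i)

  rank≡weight : (x : Str n r) → x ∈ elems n r → rank x ≡ weight x
  rank≡weight x x∈ = ≤-antisym (height≤weight (length (elems n r)) x valid)
                               (weight≤height (length (elems n r)) x valid (weight≤length x valid))
    where valid = ∈-elems⁻ x x∈

-- Counting S(n,r) by weight

listSum : List A → (A → ℕ) → ℕ
listSum []       f = 0
listSum (x ∷ xs) f = f x + listSum xs f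


listSum-++ : ∀ (xs ys : List A) f → listSum (xs ++ ys) f ≡ listSum xs f + listSum ys f
listSum-++ []       ys f = refl
listSum-++ (x ∷ xs) ys f = trans (cong (f x +_) (listSum-++ xs ys f)) (sym (+-assoc (f x) _ _))

listSum-map : ∀ (g : A → B) xs f → listSum (map g xs) f ≡ listSum xs (λ x → f (g x))
listSum-map g []       f = refl
listSum-map g (x ∷ xs) f = cong (f (g x) +_) (listSum-map g xs f)

listSum-concatMap : ∀ (g : A → List B) xs f →
                    listSum (concatMap g xs) f ≡ listSum xs (λ x → listSum (g x) f)
listSum-concatMap g []       f = refl
listSum-concatMap g (x ∷ xs) f =
  trans (listSum-++ (g x) (concatMap g xs) f) (cong (listSum (g x) f +_) (listSum-concatMap g xs f))

listSum-cong-∈ : ∀ (xs : List A) {f g : A → ℕ} → (∀ x → x ∈ xs → f x ≡ g x) → listSum xs f ≡ listSum xs g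
listSum-cong-∈ []       eq = refl
listSum-cong-∈ (x ∷ xs) eq = cong₂ _+_ (eq x (here refl)) (listSum-cong-∈ xs (λ y y∈ → eq y (there y∈)))

listSum-cong : ∀ (xs : List A) {f g : A → ℕ} → (∀ x → f x ≡ g x) → listSum xs f ≡ listSum xs g
listSum-cong xs eq = listSum-cong-∈ xs (λ x _ → eq x)

listSum-*ˡ : ∀ (xs : List A) c f → listSum xs (λ x → c * f x) ≡ c * listSum xs f
listSum-*ˡ []       c f = sym (*-zeroʳ c)
listSum-*ˡ (x ∷ xs) c f = trans (cong (c * f x +_) (listSum-*ˡ xs c f)) (sym (*-distribˡ-+ c (f x) _))

listSum-zero : ∀ (xs : List A) → listSum xs (λ _ → 0) ≡ 0
listSum-zero []       = refl
listSum-zero (_ ∷ xs) = listSum-zero xs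

listSum-filter : ∀ (P : A → Bool) xs f →
                 listSum (filter (λ x → T? (P x)) xs) f ≡ listSum xs (λ x → 𝟙 (P x) * f x)
listSum-filter P []       f = refl
listSum-filter P (x ∷ xs) f with P x
... | true  = cong₂ _+_ (sym (*-identityˡ (f x))) (listSum-filter P xs f)
... | false = listSum-filter P xs f

length-filter : ∀ (P : A → Bool) xs → length (filter (λ x → T? (P x)) xs) ≡ listSum xs (λ x → 𝟙 (P x))
length-filter P []       = refl
length-filter P (x ∷ xs) with P x
... | true  = cong suc (length-filter P xs)
... | false = length-filter P xs

listSum-tabulate : ∀ n (g : Fin n → A) (f : A → ℕ) (F : ℕ → ℕ) →
                   (∀ i → f (g i) ≡ F (toℕ i)) → listSum (tabulate g) f ≡ Σ< n F
listSum-tabulate zero    g f F eq = refl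
listSum-tabulate (suc n) g f F eq =
  cong₂ _+_ (eq fzero) (listSum-tabulate n (λ i → g (fsuc i)) f (λ i → F (suc i)) (λ i → eq (fsuc i)))

listSum-allFin : ∀ n (f : Fin n → ℕ) (F : ℕ → ℕ) → (∀ i → f i ≡ F (toℕ i)) → listSum (allFin n) f ≡ Σ< n F
listSum-allFin n f = listSum-tabulate n (λ i → i) f

listSum-allVecs-suc : ∀ (xs : List A) m (f : Vec A (suc m) → ℕ) →
  listSum (allVecs xs (suc m)) f ≡ listSum xs (λ x → listSum (allVecs xs m) (λ w → f (x ∷ w)))
listSum-allVecs-suc xs m f = trans (listSum-concatMap _ xs f)
  (listSum-cong xs (λ x → listSum-map (x ∷_) (allVecs xs m) f))

𝟙-∧ : ∀ x y z → 𝟙 (x ∧ y) * z ≡ 𝟙 x * (𝟙 y * z)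
𝟙-∧ true  y z = sym (*-identityˡ (𝟙 y * z))
𝟙-∧ false y z = refl

𝟙-guard : ∀ c {x y} → (T c → x ≡ y) → 𝟙 c * x ≡ 𝟙 c * y
𝟙-guard true  eq = cong (1 *_) (eq tt)
𝟙-guard false eq = refl

<ᵇ-via-≤ᵇ : ∀ i t → ((i ≤ᵇ t) ∧ not (t ≤ᵇ i)) ≡ (suc i ≤ᵇ t)
<ᵇ-via-≤ᵇ zero    zero    = refl
<ᵇ-via-≤ᵇ zero    (suc t) = refl
<ᵇ-via-≤ᵇ (suc i) zero    = refl
<ᵇ-via-≤ᵇ (suc i) (suc t) =
  trans (cong₂ (λ p q → p ∧ not q) (<ᵇ-suc i t) (<ᵇ-suc t i)) (<ᵇ-via-≤ᵇ i t)
  where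
  <ᵇ-suc : ∀ i t → (i <ᵇ suc t) ≡ (i ≤ᵇ t)
  <ᵇ-suc zero    t = refl
  <ᵇ-suc (suc i) t = refl

module _ {a b : ℕ} where

  listSum-allSym : (f : Sym a b → ℕ) → listSum (allSym a b) f ≡
    listSum (allFin a) (λ i → f (tl i)) + (f zS + listSum (allFin b) (λ j → f (br j)))
  listSum-allSym f = trans (listSum-++ (map tl (allFin a)) (zS ∷ map br (allFin b)) f)
    (cong₂ _+_ (listSum-map tl (allFin a) f) (cong (f zS +_) (listSum-map br (allFin b) f)))

  followsL : Sym a b → Sym a b → Bool
  followsL (br _) y = false
  followsL zS     y = isZ y
  followsL (tl i) y = y ≺ᵇ tl i

  followsR : Sym a b → Sym a b → Bool
  followsR (tl _) y = false
  followsR zS     y = true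
  followsR (br j) y = y ≺ᵇ br j

  validL-∷∷ : ∀ {m} x y (w : Vec (Sym a b) m) → validL (x ∷ y ∷ w) ≡ followsL x y ∧ validL (y ∷ w)
  validL-∷∷ (br _) y w = refl
  validL-∷∷ zS     y w = refl
  validL-∷∷ (tl _) y w = refl

  validR-∷∷ : ∀ {m} x y (w : Vec (Sym a b) m) → validR (x ∷ y ∷ w) ≡ followsR x y ∧ validR (y ∷ w)
  validR-∷∷ (tl _) y w = refl
  validR-∷∷ zS     y w = refl
  validR-∷∷ (br _) y w = refl

  leftCount : ℕ → (ℕ → ℕ) → ℕ
  leftCount m g = listSum (allVecs (allSym a b) m) (λ w → 𝟙 (validL w) * g (leftWeight w))

  leftCountAfter : ℕ → Sym a b → (ℕ → ℕ) → ℕ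
  leftCountAfter m x g = listSum (allVecs (allSym a b) m) (λ w → 𝟙 (validL (x ∷ w)) * g (leftWeight w))

  rightCount : ℕ → (ℕ → ℕ) → ℕ
  rightCount m g = listSum (allVecs (allSym a b) m) (λ w → 𝟙 (validR w) * g (rightWeight w))

  rightCountAfter : ℕ → Sym a b → (ℕ → ℕ) → ℕ
  rightCountAfter m x g = listSum (allVecs (allSym a b) m) (λ w → 𝟙 (validR (x ∷ w)) * g (rightWeight w))

  leftCountAfter-suc : ∀ m x g → leftCountAfter (suc m) x g ≡
    listSum (allSym a b) (λ y → 𝟙 (followsL x y) * leftCountAfter m y (λ j → g (tildeWeight y + j)))
  leftCountAfter-suc m x g = trans (listSum-allVecs-suc (allSym a b) m _) (listSum-cong (allSym a b) (λ y →
    trans (listSum-cong (allVecs (allSym a b) m) (λ w →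
             trans (cong (λ c → 𝟙 c * g (tildeWeight y + leftWeight w)) (validL-∷∷ x y w))
                   (𝟙-∧ (followsL x y) (validL (y ∷ w)) (g (tildeWeight y + leftWeight w)))))
          (listSum-*ˡ (allVecs (allSym a b) m) (𝟙 (followsL x y)) _)))

  rightCountAfter-suc : ∀ m x g → rightCountAfter (suc m) x g ≡
    listSum (allSym a b) (λ y → 𝟙 (followsR x y) * rightCountAfter m y (λ j → g (barWeight y + j)))
  rightCountAfter-suc m x g = trans (listSum-allVecs-suc (allSym a b) m _) (listSum-cong (allSym a b) (λ y →
    trans (listSum-cong (allVecs (allSym a b) m) (λ w →
             trans (cong (λ c → 𝟙 c * g (barWeight y + rightWeight w)) (validR-∷∷ x y w))
                   (𝟙-∧ (followsR x y) (validR (y ∷ w)) (g (barWeight y + rightWeight w)))))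
          (listSum-*ˡ (allVecs (allSym a b) m) (𝟙 (followsR x y)) _)))

  leftCountAfter-br : ∀ m j g → leftCountAfter m (br j) g ≡ 0
  leftCountAfter-br zero    j g = refl
  leftCountAfter-br (suc m) j g = trans (leftCountAfter-suc m (br j) g) (listSum-zero (allSym a b))

  leftCountAfter-zS : ∀ m g → leftCountAfter m zS g ≡ g 0
  leftCountAfter-zS zero    g = trans (+-identityʳ _) (*-identityˡ (g 0))
  leftCountAfter-zS (suc m) g = begin
    leftCountAfter (suc m) zS g
      ≡⟨ leftCountAfter-suc m zS g ⟩
    listSum (allSym a b) (λ y → 𝟙 (isZ y) * leftCountAfter m y (λ j → g (tildeWeight y + j)))
      ≡⟨ listSum-allSym _ ⟩
    listSum (allFin a) (λ _ → 0) + (1 * leftCountAfter m zS g + listSum (allFin b) (λ _ → 0))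
      ≡⟨ cong₂ _+_ (listSum-zero (allFin a))
                   (cong₂ _+_ (trans (*-identityˡ _) (leftCountAfter-zS m g)) (listSum-zero (allFin b))) ⟩
    0 + (g 0 + 0)
      ≡⟨ +-identityʳ (g 0) ⟩
    g 0 ∎
    where open ≡-Reasoning

  -- A valid left word is a decreasing run of tildes followed by 0^§'s, i.e. the set of
  -- indices of its tildes; after tl t exactly the subsets of {1, …, toℕ t} can follow.
  leftCountAfter-tl : ∀ m t g → toℕ t ≤ m → leftCountAfter m (tl t) g ≡ subsetSum (toℕ t) g
  leftCountAfter-tl zero    t g t≤0 = trans (trans (+-identityʳ _) (*-identityˡ (g 0)))
                                            (cong (λ c → subsetSum c g) (sym (n≤0⇒n≡0 t≤0)))
  leftCountAfter-tl (suc m) t g t≤m = begin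
    leftCountAfter (suc m) (tl t) g
      ≡⟨ leftCountAfter-suc m (tl t) g ⟩
    listSum (allSym a b) (λ y → 𝟙 (followsL (tl t) y) * leftCountAfter m y (λ j → g (tildeWeight y + j)))
      ≡⟨ listSum-allSym _ ⟩
    listSum (allFin a) (λ i → 𝟙 (tl {b = b} i ≺ᵇ tl t) * leftCountAfter m (tl i) (λ j → g (suc (toℕ i) + j)))
      + (1 * leftCountAfter m zS g + listSum (allFin b) (λ j → 1 * leftCountAfter m (br j) g))
      ≡⟨ cong₂ _+_ (listSum-allFin a _ (λ i → 𝟙 (suc i ≤ᵇ toℕ t) * H i) below-t)
                   (cong₂ _+_ (trans (*-identityˡ _) (leftCountAfter-zS m g))
                              (trans (listSum-cong (allFin b) (λ j → trans (*-identityˡ _) (leftCountAfter-br m j g)))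
                                     (listSum-zero (allFin b)))) ⟩
    Σ< a (λ i → 𝟙 (suc i ≤ᵇ toℕ t) * H i) + (g 0 + 0)
      ≡⟨ cong₂ _+_ (Σ<-prefix a (toℕ t) H (<⇒≤ (toℕ<n t))) (+-identityʳ (g 0)) ⟩
    Σ< (toℕ t) H + g 0
      ≡⟨ +-comm (Σ< (toℕ t) H) (g 0) ⟩
    g 0 + Σ< (toℕ t) H
      ≡⟨ sym (subsetSum-byMax (toℕ t) g) ⟩
    subsetSum (toℕ t) g ∎
    where
    open ≡-Reasoning
    H : ℕ → ℕ
    H i = subsetSum i (λ j → g (suc i + j))
    below-t : ∀ i → 𝟙 (tl {b = b} i ≺ᵇ tl t) * leftCountAfter m (tl i) (λ j → g (suc (toℕ i) + j))
                    ≡ 𝟙 (suc (toℕ i) ≤ᵇ toℕ t) * H (toℕ i)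
    below-t i = trans (cong (λ c → 𝟙 c * leftCountAfter m (tl i) (λ j → g (suc (toℕ i) + j)))
                            (<ᵇ-via-≤ᵇ (toℕ i) (toℕ t)))
      (𝟙-guard (suc (toℕ i) ≤ᵇ toℕ t) (λ i<t →
        leftCountAfter-tl m i _ (≤-pred (≤-trans (≤ᵇ⇒≤ (suc (toℕ i)) (toℕ t) i<t) t≤m))))

  leftCount≡subsetSum : ∀ m g → a ≤ m → leftCount m g ≡ subsetSum a g
  leftCount≡subsetSum zero    g a≤0 = trans (trans (+-identityʳ _) (*-identityˡ (g 0)))
                                            (cong (λ c → subsetSum c g) (sym (n≤0⇒n≡0 a≤0)))
  leftCount≡subsetSum (suc m) g a≤m = begin
    leftCount (suc m) g
      ≡⟨ listSum-allVecs-suc (allSym a b) m _ ⟩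
    listSum (allSym a b) (λ y → leftCountAfter m y (λ j → g (tildeWeight y + j)))
      ≡⟨ listSum-allSym _ ⟩
    listSum (allFin a) (λ i → leftCountAfter m (tl i) (λ j → g (suc (toℕ i) + j)))
      + (leftCountAfter m zS g + listSum (allFin b) (λ j → leftCountAfter m (br j) g))
      ≡⟨ cong₂ _+_ (listSum-allFin a _ H (λ i →
                      leftCountAfter-tl m i _ (≤-pred (≤-trans (toℕ<n i) a≤m))))
                   (cong₂ _+_ (leftCountAfter-zS m g)
                              (trans (listSum-cong (allFin b) (λ j → leftCountAfter-br m j g))
                                     (listSum-zero (allFin b)))) ⟩
    Σ< a H + (g 0 + 0)
      ≡⟨ trans (cong (Σ< a H +_) (+-identityʳ (g 0))) (+-comm (Σ< a H) (g 0)) ⟩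
    g 0 + Σ< a H
      ≡⟨ sym (subsetSum-byMax a g) ⟩
    subsetSum a g ∎
    where
    open ≡-Reasoning
    H : ℕ → ℕ
    H i = subsetSum i (λ j → g (suc i + j))

  rightCountAfter-tl : ∀ m i g → rightCountAfter m (tl i) g ≡ 0
  rightCountAfter-tl zero    i g = refl
  rightCountAfter-tl (suc m) i g = trans (rightCountAfter-suc m (tl i) g) (listSum-zero (allSym a b))

  rightCountAfter-zS : ∀ m g → rightCountAfter m zS g ≡ rightCount m g
  rightCountAfter-zS zero    g = refl
  rightCountAfter-zS (suc m) g = trans (rightCountAfter-suc m zS g)
    (trans (listSum-cong (allSym a b) (λ y → *-identityˡ _)) (sym (listSum-allVecs-suc (allSym a b) m _)))

  -- After br j only bars of larger index can follow, and no 0^§.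
  rightCountAfter-br : ∀ m j g → rightCountAfter m (br j) g ≡ exactSubsetSum b m (suc (toℕ j)) g
  rightCountAfter-br zero    j g = trans (+-identityʳ _) (*-identityˡ (g 0))
  rightCountAfter-br (suc m) j g = begin
    rightCountAfter (suc m) (br j) g
      ≡⟨ rightCountAfter-suc m (br j) g ⟩
    listSum (allSym a b) (λ y → 𝟙 (y ≺ᵇ br j) * rightCountAfter m y (λ k → g (barWeight y + k)))
      ≡⟨ listSum-allSym _ ⟩
    listSum (allFin a) (λ _ → 0)
      + (0 + listSum (allFin b) (λ i → 𝟙 (br {a} i ≺ᵇ br j) * rightCountAfter m (br i) (λ k → g (suc (toℕ i) + k))))
      ≡⟨ cong₂ _+_ (listSum-zero (allFin a)) (listSum-allFin b _ _ (λ i →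
           cong₂ _*_ (cong 𝟙 (<ᵇ-via-≤ᵇ (toℕ j) (toℕ i))) (rightCountAfter-br m i _))) ⟩
    exactSubsetSum b (suc m) (suc (toℕ j)) g ∎
    where open ≡-Reasoning

  rightCount≡boundedSubsetSum : ∀ m g → rightCount m g ≡ boundedSubsetSum b m g
  rightCount≡boundedSubsetSum zero    g = trans (+-identityʳ _) (*-identityˡ (g 0))
  rightCount≡boundedSubsetSum (suc m) g = begin
    rightCount (suc m) g
      ≡⟨ listSum-allVecs-suc (allSym a b) m _ ⟩
    listSum (allSym a b) (λ y → rightCountAfter m y (λ k → g (barWeight y + k)))
      ≡⟨ listSum-allSym _ ⟩
    listSum (allFin a) (λ i → rightCountAfter m (tl i) g)
      + (rightCountAfter m zS g + listSum (allFin b) (λ i → rightCountAfter m (br i) (λ k → g (suc (toℕ i) + k))))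
      ≡⟨ cong₂ _+_ (trans (listSum-cong (allFin a) (λ i → rightCountAfter-tl m i g)) (listSum-zero (allFin a)))
                   (cong₂ _+_ (trans (rightCountAfter-zS m g) (rightCount≡boundedSubsetSum m g))
                              (listSum-allFin b _ _ (λ i →
                                 trans (rightCountAfter-br m i _) (sym (*-identityˡ _))))) ⟩
    boundedSubsetSum b (suc m) g ∎
    where open ≡-Reasoning

-- pairSubsetSum r b h = Σ h (Σ S + Σ S′) over S ⊆ {1, …, r} and S′ ⊆ {1, …, b}
pairSubsetSum : ℕ → ℕ → (ℕ → ℕ) → ℕ
pairSubsetSum r b h = subsetSum r (λ i → subsetSum b (λ j → h (i + j)))

pairSubsetSum-cong : ∀ r b {h h′ : ℕ → ℕ} → (∀ e → h e ≡ h′ e) → pairSubsetSum r b h ≡ pairSubsetSum r b h′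
pairSubsetSum-cong r b eq = subsetSum-cong r (λ i _ → subsetSum-cong b (λ j _ → eq (i + j)))

pairSubsetSum-vanish : ∀ r b h → (∀ e → e ≤ tri r + tri b → h e ≡ 0) → pairSubsetSum r b h ≡ 0
pairSubsetSum-vanish r b h h≡0 = trans (subsetSum-cong r (λ i i≤ →
  trans (subsetSum-cong b (λ j j≤ → h≡0 (i + j) (+-mono-≤ i≤ j≤))) (subsetSum-zero b))) (subsetSum-zero r)

pairSubsetSum-suc : ∀ r b h →
  pairSubsetSum r (suc b) h ≡ pairSubsetSum r b h + pairSubsetSum r b (λ e → h (suc b + e))
pairSubsetSum-suc r b h = trans
  (subsetSum-cong r (λ i _ → cong (subsetSum b (λ j → h (i + j)) +_)
    (subsetSum-cong b (λ j _ → cong h (x∙yz≈y∙xz i (suc b) j)))))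
  (subsetSum-+ r _ _)

pairSubsetSum-zeroʳ : ∀ t h → pairSubsetSum t 0 h ≡ pairSubsetSum 0 t h
pairSubsetSum-zeroʳ t h = subsetSum-cong t (λ i _ → cong h (+-identityʳ i))

-- weight x ranges over Σ S + Σ S′, where S = the tilde indices of x and
-- S′ = the bar indices missing from x.
listSum-elems : ∀ n r (h : ℕ → ℕ) →
                listSum (elems n r) (λ x → h (weight x)) ≡ pairSubsetSum r (n ∸ r) h
listSum-elems n r h = begin
  listSum (elems n r) (λ x → h (weight x))
    ≡⟨ listSum-filter isS (concatMap (λ u → map (u ,_) Vs) Us) _ ⟩
  listSum (concatMap (λ u → map (u ,_) Vs) Us) (λ x → 𝟙 (isS x) * h (weight x))
    ≡⟨ listSum-concatMap _ Us _ ⟩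
  listSum Us (λ u → listSum (map (u ,_) Vs) (λ x → 𝟙 (isS x) * h (weight x)))
    ≡⟨ listSum-cong Us split ⟩
  leftCount r G
    ≡⟨ leftCount≡subsetSum {r} {b} r G ≤-refl ⟩
  subsetSum r G
    ≡⟨ subsetSum-cong r (λ i _ → trans (boundedSubsetSum-full b _) (subsetSum-complement b (λ j → h (i + j)))) ⟩
  pairSubsetSum r b h ∎
  where
  open ≡-Reasoning
  b = n ∸ r
  Us = allVecs (allSym r b) r
  Vs = allVecs (allSym r b) b
  G : ℕ → ℕ
  G i = boundedSubsetSum b b (λ j → h (i + (tri b ∸ j)))
  split : ∀ u → listSum (map (u ,_) Vs) (λ x → 𝟙 (isS x) * h (weight x)) ≡ 𝟙 (validL u) * G (leftWeight u)
  split u = begin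
    listSum (map (u ,_) Vs) (λ x → 𝟙 (isS x) * h (weight x))
      ≡⟨ listSum-map (u ,_) Vs _ ⟩
    listSum Vs (λ v → 𝟙 (validL u ∧ validR v) * h (leftWeight u + (tri b ∸ rightWeight v)))
      ≡⟨ listSum-cong Vs (λ v → 𝟙-∧ (validL u) (validR v) _) ⟩
    listSum Vs (λ v → 𝟙 (validL u) * (𝟙 (validR v) * h (leftWeight u + (tri b ∸ rightWeight v))))
      ≡⟨ listSum-*ˡ Vs (𝟙 (validL u)) _ ⟩
    𝟙 (validL u) * rightCount {r} {b} b (λ j → h (leftWeight u + (tri b ∸ j)))
      ≡⟨ cong (𝟙 (validL u) *_) (rightCount≡boundedSubsetSum {r} {b} b _) ⟩
    𝟙 (validL u) * G (leftWeight u) ∎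

s≡pairSubsetSum : ∀ n r k → s n r k ≡ pairSubsetSum r (n ∸ r) (λ e → 𝟙 (e ≡ᵇ k))
s≡pairSubsetSum n r k = begin
  s n r k
    ≡⟨ length-filter (λ x → rank x ≡ᵇ k) (elems n r) ⟩
  listSum (elems n r) (λ x → 𝟙 (rank x ≡ᵇ k))
    ≡⟨ listSum-cong-∈ (elems n r) (λ x x∈ → cong (λ c → 𝟙 (c ≡ᵇ k)) (rank≡weight x x∈)) ⟩
  listSum (elems n r) (λ x → 𝟙 (weight x ≡ᵇ k))
    ≡⟨ listSum-elems n r (λ e → 𝟙 (e ≡ᵇ k)) ⟩
  pairSubsetSum r (n ∸ r) (λ e → 𝟙 (e ≡ᵇ k)) ∎
  where open ≡-Reasoning

-- The recurrence

≢⇒≡ᵇ-false : ∀ m n → m ≢ n → (m ≡ᵇ n) ≡ false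
≢⇒≡ᵇ-false m n m≢n with m ≡ᵇ n in eq
... | true  = ⊥-elim (m≢n (≡ᵇ⇒≡ m n (Equivalence.from T-≡ eq)))
... | false = refl

+-≡ᵇ-∸ : ∀ c e k → c ≤ k → ((c + e) ≡ᵇ k) ≡ (e ≡ᵇ (k ∸ c))
+-≡ᵇ-∸ zero    e k       _         = refl
+-≡ᵇ-∸ (suc c) e (suc k) (s≤s c≤k) = +-≡ᵇ-∸ c e k c≤k

R≡tri+tri : ∀ m r → R m r ≡ tri r + tri (m ∸ r)
R≡tri+tri m r = cong₂ _+_ (tri≡C2 r) (tri≡C2 (m ∸ r))

s-suc : ∀ m r k → r ≤ m →
  s (suc m) r k ≡ s m r k + pairSubsetSum r (m ∸ r) (λ e → 𝟙 ((suc (m ∸ r) + e) ≡ᵇ k))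
s-suc m r k r≤m = begin
  s (suc m) r k                       ≡⟨ s≡pairSubsetSum (suc m) r k ⟩
  pairSubsetSum r (suc m ∸ r) δ       ≡⟨ cong (λ c → pairSubsetSum r c δ) (+-∸-assoc 1 r≤m) ⟩
  pairSubsetSum r (suc (m ∸ r)) δ     ≡⟨ pairSubsetSum-suc r (m ∸ r) δ ⟩
  pairSubsetSum r (m ∸ r) δ + shifted ≡⟨ cong (_+ shifted) (sym (s≡pairSubsetSum m r k)) ⟩
  s m r k + shifted                   ∎
  where
  open ≡-Reasoning
  δ : ℕ → ℕ
  δ e = 𝟙 (e ≡ᵇ k)
  shifted = pairSubsetSum r (m ∸ r) (λ e → δ (suc (m ∸ r) + e))

shifted-below : ∀ r b c k → k < c → pairSubsetSum r b (λ e → 𝟙 ((c + e) ≡ᵇ k)) ≡ 0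
shifted-below r b c k k<c = pairSubsetSum-vanish r b _ (λ e _ →
  cong 𝟙 (≢⇒≡ᵇ-false (c + e) k (λ c+e≡k → <⇒≱ k<c (subst (c ≤_) c+e≡k (m≤m+n c e)))))

shifted-above : ∀ m r k → suc (m ∸ r) ≤ k →
  pairSubsetSum r (m ∸ r) (λ e → 𝟙 ((suc (m ∸ r) + e) ≡ᵇ k)) ≡ s m r (k ∸ suc (m ∸ r))
shifted-above m r k c≤k = trans (pairSubsetSum-cong r (m ∸ r) (λ e → cong 𝟙 (+-≡ᵇ-∸ (suc (m ∸ r)) e k c≤k)))
                                (sym (s≡pairSubsetSum m r (k ∸ suc (m ∸ r))))

s-beyondRank : ∀ m r k → R m r < k → s m r k ≡ 0
s-beyondRank m r k R<k = trans (s≡pairSubsetSum m r k) (pairSubsetSum-vanish r (m ∸ r) _ (λ e e≤ →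
  cong 𝟙 (≢⇒≡ᵇ-false e k (λ e≡k → <⇒≱ R<k (subst (_≤ R m r) e≡k
    (≤-trans e≤ (≤-reflexive (sym (R≡tri+tri m r)))))))))

Recurrence : ℕ → ℕ → ℕ → ℕ → Set
Recurrence m r k c =
    (k < c → s (suc m) r k ≡ s m r k)
  × (c ≤ k → k ≤ R m r → s (suc m) r k ≡ s m r k + s m r (k ∸ c))
  × (R m r < k → k ≤ R (suc m) r → s (suc m) r k ≡ s m r (k ∸ c))

s-recurrence : ∀ m r k → r ≤ m → Recurrence m r k (suc (m ∸ r))
s-recurrence m r k r≤m =
    (λ k<c → trans (s-suc m r k r≤m) (trans (cong (s m r k +_) (shifted-below r b c k k<c)) (+-identityʳ _)))
  , (λ c≤k _ → trans (s-suc m r k r≤m) (cong (s m r k +_) (shifted-above m r k c≤k)))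
  , (λ R<k _ → trans (s-suc m r k r≤m) (cong₂ _+_ (s-beyondRank m r k R<k) (shifted-above m r k (c≤k R<k))))
  where
  b = m ∸ r
  c = suc b
  c≤k : R m r < k → c ≤ k
  c≤k R<k = ≤-trans (s≤s (≤-trans (n≤tri b) (m≤n+m (tri b) (tri r)))) (subst (_< k) (R≡tri+tri m r) R<k)

s-full≡s-empty : ∀ n k → s n n k ≡ s n 0 k
s-full≡s-empty n k = begin
  s n n k                                   ≡⟨ s≡pairSubsetSum n n k ⟩
  pairSubsetSum n (n ∸ n) (λ e → 𝟙 (e ≡ᵇ k)) ≡⟨ cong (λ c → pairSubsetSum n c (λ e → 𝟙 (e ≡ᵇ k))) (n∸n≡0 n) ⟩
  pairSubsetSum n 0 (λ e → 𝟙 (e ≡ᵇ k))       ≡⟨ pairSubsetSum-zeroʳ n _ ⟩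
  pairSubsetSum 0 n (λ e → 𝟙 (e ≡ᵇ k))       ≡⟨ sym (s≡pairSubsetSum n 0 k) ⟩
  s n 0 k                                   ∎
  where open ≡-Reasoning

mainTheorem12 : (m : ℕ) →
    ((r k : ℕ) → r < suc m →
        (k < suc m ∸ r → s (suc m) r k ≡ s m r k)
      × (suc m ∸ r ≤ k → k ≤ R m r →
           s (suc m) r k ≡ s m r k + s m r (k ∸ (suc m ∸ r)))
      × (R m r < k → k ≤ R (suc m) r →
           s (suc m) r k ≡ s m r (k ∸ (suc m ∸ r))))
    × ((k : ℕ) → s (suc m) (suc m) k ≡ s (suc m) 0 k)
mainTheorem12 m =
    (λ r k r<1+m → subst (Recurrence m r k) (sym (+-∸-assoc 1 (≤-pred r<1+m)))
                         (s-recurrence m r k (≤-pred r<1+m)))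
  , s-full≡s-empty (suc m)
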